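{- Let $\Gamma$ be a finite, simple, connected, undirected $2$-distance-transitive graph of valency $k\ge3$. Then either (1) $\Gamma$ is a distance-transitive strongly regular graph, or (2) $\Gamma$ has diameter $d\ge3$ and $b_1\ge\max\{c_2,\frac{1}{3}(k+1)\}$.
   Context: $\Gamma$ is $2$-distance-transitive if it has diameter at least $2$, $\mathrm{Aut}(\Gamma)$ is vertex-transitive, and each $\mathrm{Aut}(\Gamma)_u$ is transitive on the vertices at distance $1$ and at distance $2$ from $u$. For $u$ and a neighbour $v$, $b_1$ is the number of neighbours of $v$ at distance $2$ from $u$; $c_2$ is the number of common neighbours of two vertices at distance $2$. -}

module Defs where

open import Data.Nat using (ℕ; zero; suc; _+_; _*_; _≤_)
open import Data.Bool using (Bool; true; false; _∧_; _∨_; not; if_then_else_)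
open import Data.Fin using (Fin; zero; suc; _≟_)
open import Data.Fin.Permutation using (Permutation′; _⟨$⟩ʳ_)
open import Data.Product using (Σ; ∃; ∃-syntax; _×_; _,_)
open import Relation.Nullary using (¬_)
open import Relation.Nullary.Decidable using (isYes)
open import Relation.Binary.PropositionalEquality using (_≡_)

record Graph (n : ℕ) : Set where
  field
    adj    : Fin n → Fin n → Bool
    sym    : ∀ u v → adj u v ≡ adj v u
    irrefl : ∀ u → adj u u ≡ false
open Graph public

anyF : ∀ {n} → (Fin n → Bool) → Bool
anyF {zero}  p = false
anyF {suc n} p = p zero ∨ anyF (λ i → p (suc i))

countF : ∀ {n} → (Fin n → Bool) → ℕ
countF {zero}  p = 0
countF {suc n} p = (if p zero then 1 else 0) + countF (λ i → p (suc i))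

module _ {n : ℕ} (G : Graph n) where

  distLe : ℕ → Fin n → Fin n → Bool
  distLe zero    u v = isYes (u ≟ v)
  distLe (suc m) u v = isYes (u ≟ v) ∨ anyF (λ w → adj G u w ∧ distLe m w v)

  isDist : ℕ → Fin n → Fin n → Bool
  isDist zero    u v = distLe zero u v
  isDist (suc i) u v = distLe (suc i) u v ∧ not (distLe i u v)

  Connected : Set
  Connected = ∀ u v → ∃[ m ] distLe m u v ≡ true

  HasValency : ℕ → Set
  HasValency k = ∀ v → countF (adj G v) ≡ k

  HasDiameter : ℕ → Set
  HasDiameter d = (∃[ u ] ∃[ v ] isDist d u v ≡ true) × (∀ u v → distLe d u v ≡ true)

  IsAut : Permutation′ n → Set
  IsAut σ = ∀ u v → adj G (σ ⟨$⟩ʳ u) (σ ⟨$⟩ʳ v) ≡ adj G u v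

  VertexTransitive : Set
  VertexTransitive = ∀ u v → ∃[ σ ] IsAut σ × σ ⟨$⟩ʳ u ≡ v

  LocallyTransitiveAt : ℕ → Set
  LocallyTransitiveAt i = ∀ u v w → isDist i u v ≡ true → isDist i u w ≡ true →
    ∃[ σ ] IsAut σ × σ ⟨$⟩ʳ u ≡ u × σ ⟨$⟩ʳ v ≡ w

  DiameterAtLeast2 : Set
  DiameterAtLeast2 = ∃[ u ] ∃[ v ] isDist 2 u v ≡ true

  TwoDistanceTransitive : Set
  TwoDistanceTransitive =
    DiameterAtLeast2 × VertexTransitive × LocallyTransitiveAt 1 × LocallyTransitiveAt 2

  DistanceTransitive : Set
  DistanceTransitive = ∀ i u v u' v' → isDist i u v ≡ true → isDist i u' v' ≡ true →
    ∃[ σ ] IsAut σ × σ ⟨$⟩ʳ u ≡ u' × σ ⟨$⟩ʳ v ≡ v'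

  commonNbrs : Fin n → Fin n → ℕ
  commonNbrs u v = countF (λ w → adj G u w ∧ adj G v w)

  StronglyRegular : ℕ → Set
  StronglyRegular k = HasValency k × ∃[ l ] ∃[ μ ]
    ((∀ u v → adj G u v ≡ true → commonNbrs u v ≡ l) ×
     (∀ u v → ¬ (u ≡ v) → adj G u v ≡ false → commonNbrs u v ≡ μ))

  b1 : Fin n → Fin n → ℕ
  b1 u v = countF (λ w → adj G v w ∧ isDist 2 u w)

  -- c₂(u,w): common neighbours of u and w (used when d(u,w) = 2)
  c2 : Fin n → Fin n → ℕ
  c2 = commonNbrs

{-# OPTIONS --safe #-}
-- If no two vertices are at distance 3, the diameter is 2, so Aut Γ is transitive on the
-- pairs at each distance 0, 1, 2: Γ is distance-transitive, and strongly regular because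
-- a₁ and c₂ are constant.  Otherwise arc-transitivity puts every arc uv on a geodesic
-- u v w x.  The common neighbours of v and x lie in Γ(v) ∩ Γ₂(u), so c₂ ≤ b₁.  Counting
-- Γ(v) gives k ≤ 1 + a₁ + b₁, and splitting Γ(v) ∩ Γ(w) by the distance to u gives
-- a₁ + 2 ≤ c₂ + b₁, with v and w witnessing the two strict inequalities; hence
-- k + 1 ≤ c₂ + 2b₁ ≤ 3b₁.
module Submission where

open import Defs
open import Data.Nat using (ℕ; zero; suc; _+_; _*_; _≤_; _<_; _⊔_; z≤n; s≤s)
open import Data.Nat.Properties
  using (≤-refl; ≤-trans; m≤n+m; m≤m+n; m≤m⊔n; m≤n⊔m; n≤1+n; +-mono-≤; +-monoˡ-≤; +-comm; +-suc; +-assoc;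
         +-identityʳ; ≰⇒>; +-commutativeSemigroup; +-0-commutativeMonoid; module ≤-Reasoning)
open import Data.Bool using (Bool; true; false; _∧_; _∨_; not; if_then_else_)
open import Data.Bool.Properties
  using (∧-conicalˡ; ∧-conicalʳ; ∧-zeroʳ; ∨-zeroʳ; ¬-not; not-¬; T-≡) renaming (_≟_ to _≟ᵇ_)
open import Data.Fin using (Fin; zero; suc; _≟_)
open import Data.Fin.Properties using (any?; all?; ¬∀⟶∃¬; suc-injective)
open import Data.Fin.Permutation using (Permutation′; _⟨$⟩ʳ_; _⟨$⟩ˡ_; _∘ₚ_; flip; inverseˡ; inverseʳ)
open import Data.Product using (∃; ∃₂; ∃-syntax; _×_; _,_; proj₁; proj₂)
open import Data.Sum using (_⊎_; inj₁; inj₂; map₂; [_,_]′)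
open import Function using (_∘_; Equivalence)
open import Relation.Nullary using (¬_; Dec; yes; no; contradiction)
open import Relation.Nullary.Decidable using (isYes; isYes≗does; dec-true; toWitness; map′)
open import Relation.Unary using (Decidable)
open import Relation.Binary.PropositionalEquality
  using (_≡_; _≢_; refl; trans; cong; cong₂; subst; subst₂; module ≡-Reasoning) renaming (sym to ≡-sym)
open import Algebra.Properties.CommutativeSemigroup +-commutativeSemigroup using (interchange)
open import Algebra.Properties.CommutativeMonoid.Sum +-0-commutativeMonoid using (sum; sum-permute)

∨-elim : ∀ {a b} → a ∨ b ≡ true → a ≡ true ⊎ b ≡ true
∨-elim {true}  _ = inj₁ refl
∨-elim {false} e = inj₂ e

∨-introʳ : ∀ a {b} → b ≡ true → a ∨ b ≡ true
∨-introʳ a e = trans (cong (a ∨_) e) (∨-zeroʳ a)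

≡-from-true⇔true : ∀ {a b} → (a ≡ true → b ≡ true) → (b ≡ true → a ≡ true) → a ≡ b
≡-from-true⇔true {false} {false} _ _ = refl
≡-from-true⇔true {false} {true}  _ b→a = b→a refl
≡-from-true⇔true {true}  a→b _ = ≡-sym (a→b refl)

isYes-sound : ∀ {a} {A : Set a} {d : Dec A} → isYes d ≡ true → A
isYes-sound e = toWitness (Equivalence.from T-≡ e)

isYes-complete : ∀ {a} {A : Set a} (d : Dec A) → A → isYes d ≡ true
isYes-complete d x = trans (isYes≗does d) (dec-true d x)

anyF-intro : ∀ {n} (p : Fin n → Bool) i → p i ≡ true → anyF p ≡ true
anyF-intro p zero    e = cong (_∨ anyF (p ∘ suc)) e
anyF-intro p (suc i) e = ∨-introʳ (p zero) (anyF-intro (p ∘ suc) i e)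

anyF-elim : ∀ {n} (p : Fin n → Bool) → anyF p ≡ true → ∃ λ i → p i ≡ true
anyF-elim {zero}  p ()
anyF-elim {suc n} p e with ∨-elim {p zero} e
... | inj₁ e₀ = zero , e₀
... | inj₂ e₁ with anyF-elim (p ∘ suc) e₁
...   | i , eᵢ = suc i , eᵢ

𝟙 : Bool → ℕ
𝟙 b = if b then 1 else 0

𝟙≤1 : ∀ a → 𝟙 a ≤ 1
𝟙≤1 false = z≤n
𝟙≤1 true  = ≤-refl

𝟙-mono : ∀ {a b} → (a ≡ true → b ≡ true) → 𝟙 a ≤ 𝟙 b
𝟙-mono {false} _ = z≤n
𝟙-mono {true}  h rewrite h refl = ≤-refl

𝟙-∪ : ∀ {a b c} → (a ≡ true → b ≡ true ⊎ c ≡ true) → 𝟙 a ≤ 𝟙 b + 𝟙 c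
𝟙-∪ {false} _ = z≤n
𝟙-∪ {true} h with h refl
... | inj₁ refl = s≤s z≤n
... | inj₂ refl = m≤n+m 1 _

_⊆_ : ∀ {n} → (p q : Fin n → Bool) → Set
p ⊆ q = ∀ i → p i ≡ true → q i ≡ true

countF-mono : ∀ {n} {p q : Fin n → Bool} → p ⊆ q → countF p ≤ countF q
countF-mono {zero}  _ = z≤n
countF-mono {suc n} p⊆q = +-mono-≤ (𝟙-mono (p⊆q zero)) (countF-mono (p⊆q ∘ suc))

countF-mono-< : ∀ {n} {p q : Fin n → Bool} → p ⊆ q → ∀ j → q j ≡ true → p j ≡ false → countF p < countF q
countF-mono-< {p = p} {q} p⊆q zero qⱼ pⱼ rewrite qⱼ | pⱼ = s≤s (countF-mono (p⊆q ∘ suc))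
countF-mono-< {p = p} {q} p⊆q (suc j) qⱼ pⱼ = begin
  suc (𝟙 (p zero) + countF (p ∘ suc)) ≡⟨ +-suc (𝟙 (p zero)) _ ⟨
  𝟙 (p zero) + suc (countF (p ∘ suc)) ≤⟨ +-mono-≤ (𝟙-mono (p⊆q zero)) (countF-mono-< (p⊆q ∘ suc) j qⱼ pⱼ) ⟩
  𝟙 (q zero) + countF (q ∘ suc)       ∎
  where open ≤-Reasoning

countF-⊆-∪ : ∀ {n} {p q r : Fin n → Bool} → (∀ i → p i ≡ true → q i ≡ true ⊎ r i ≡ true) →
  countF p ≤ countF q + countF r
countF-⊆-∪ {zero} _ = z≤n
countF-⊆-∪ {suc n} {p} {q} {r} cover = begin
  𝟙 (p zero) + countF (p ∘ suc)
    ≤⟨ +-mono-≤ (𝟙-∪ (cover zero)) (countF-⊆-∪ (cover ∘ suc)) ⟩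
  (𝟙 (q zero) + 𝟙 (r zero)) + (countF (q ∘ suc) + countF (r ∘ suc))
    ≡⟨ interchange (𝟙 (q zero)) (𝟙 (r zero)) (countF (q ∘ suc)) (countF (r ∘ suc)) ⟩
  (𝟙 (q zero) + countF (q ∘ suc)) + (𝟙 (r zero) + countF (r ∘ suc)) ∎
  where open ≤-Reasoning

countF-⊆-∪-< : ∀ {n} {p q r : Fin n → Bool} → (∀ i → p i ≡ true → q i ≡ true ⊎ r i ≡ true) →
  ∀ i j → q i ≡ true → p i ≡ false → r j ≡ true → p j ≡ false → 2 + countF p ≤ countF q + countF r
countF-⊆-∪-< {p = p} {q} {r} cover i j qᵢ pᵢ rⱼ pⱼ = begin
  2 + countF p                                  ≤⟨ s≤s (s≤s (countF-⊆-∪ {q = p∧q} {r = p∧r} split)) ⟩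
  2 + (countF p∧q + countF p∧r)                 ≡⟨ cong suc (+-suc (countF p∧q) _) ⟨
  suc (countF p∧q) + suc (countF p∧r)           ≤⟨ +-mono-≤ (countF-mono-< proj-q i qᵢ (cong (_∧ q i) pᵢ))
                                                             (countF-mono-< proj-r j rⱼ (cong (_∧ r j) pⱼ)) ⟩
  countF q + countF r                           ∎
  where
  open ≤-Reasoning
  p∧q p∧r : Fin _ → Bool
  p∧q k = p k ∧ q k
  p∧r k = p k ∧ r k
  split : ∀ k → p k ≡ true → p∧q k ≡ true ⊎ p∧r k ≡ true
  split k pₖ with cover k pₖ
  ... | inj₁ qₖ = inj₁ (cong₂ _∧_ pₖ qₖ)
  ... | inj₂ rₖ = inj₂ (cong₂ _∧_ pₖ rₖ)
  proj-q : p∧q ⊆ q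
  proj-q k = ∧-conicalʳ (p k) (q k)
  proj-r : p∧r ⊆ r
  proj-r k = ∧-conicalʳ (p k) (r k)

countF-⊆-except : ∀ {n} {p q : Fin n → Bool} j → (∀ i → i ≢ j → p i ≡ true → q i ≡ true) →
  countF p ≤ suc (countF q)
countF-⊆-except {p = p} {q} zero h =
  +-mono-≤ (𝟙≤1 (p zero)) (≤-trans (countF-mono (λ i → h (suc i) λ ())) (m≤n+m _ (𝟙 (q zero))))
countF-⊆-except {p = p} {q} (suc j) h = begin
  𝟙 (p zero) + countF (p ∘ suc)
    ≤⟨ +-mono-≤ (𝟙-mono (h zero λ ())) (countF-⊆-except j λ i i≢j → h (suc i) (i≢j ∘ suc-injective)) ⟩
  𝟙 (q zero) + suc (countF (q ∘ suc))
    ≡⟨ +-suc (𝟙 (q zero)) _ ⟩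
  suc (countF q) ∎
  where open ≤-Reasoning

countF-cong : ∀ {n} {p q : Fin n → Bool} → (∀ i → p i ≡ q i) → countF p ≡ countF q
countF-cong {zero}  _ = refl
countF-cong {suc n} p≗q = cong₂ _+_ (cong 𝟙 (p≗q zero)) (countF-cong (p≗q ∘ suc))

countF≡sum : ∀ {n} (p : Fin n → Bool) → countF p ≡ sum (𝟙 ∘ p)
countF≡sum {zero}  p = refl
countF≡sum {suc n} p = cong (𝟙 (p zero) +_) (countF≡sum (p ∘ suc))

countF-permute : ∀ {n} (p : Fin n → Bool) (σ : Permutation′ n) → countF (p ∘ (σ ⟨$⟩ʳ_)) ≡ countF p
countF-permute p σ = begin
  countF (p ∘ (σ ⟨$⟩ʳ_)) ≡⟨ countF≡sum (p ∘ (σ ⟨$⟩ʳ_)) ⟩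
  sum (𝟙 ∘ p ∘ (σ ⟨$⟩ʳ_)) ≡⟨ sum-permute (𝟙 ∘ p) σ ⟨
  sum (𝟙 ∘ p)            ≡⟨ countF≡sum p ⟨
  countF p               ∎
  where open ≡-Reasoning

uniform-bound : ∀ {p n} {P : ℕ → Fin n → Set p} → (∀ {m m' i} → m ≤ m' → P m i → P m' i) →
  (∀ i → ∃[ m ] P m i) → ∃[ M ] ∀ i → P M i
uniform-bound {n = zero}  _ _ = 0 , λ ()
uniform-bound {n = suc n} {P} mono bound
  with bound zero | uniform-bound {P = λ m i → P m (suc i)} mono (bound ∘ suc)
... | m₀ , P₀ | M , Pₛ = m₀ ⊔ M , λ { zero → mono (m≤m⊔n m₀ M) P₀ ; (suc i) → mono (m≤n⊔m m₀ M) (Pₛ i) }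

descend : ∀ {p} {P : ℕ → Set p} → Decidable P → ∀ {M} → P M → ∃[ d ] P d × (∀ {d'} → d ≡ suc d' → ¬ P d')
descend P? {zero}  P₀ = 0 , P₀ , λ ()
descend P? {suc M} Pₛ with P? M
... | yes P′ = descend P? P′
... | no ¬P′ = suc M , Pₛ , λ { refl → ¬P′ }

module _ {n : ℕ} (G : Graph n) where

  data Within : ℕ → Fin n → Fin n → Set where
    here : ∀ {m u} → Within m u u
    step : ∀ {m u w v} → adj G u w ≡ true → Within m w v → Within (suc m) u v

  Within-mono : ∀ {m m' u v} → m ≤ m' → Within m u v → Within m' u v
  Within-mono _          here       = here
  Within-mono (s≤s m≤m') (step a w) = step a (Within-mono m≤m' w)

  Within-snoc : ∀ {m u x y} → Within m u x → adj G x y ≡ true → Within (suc m) u y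
  Within-snoc here       a = step a here
  Within-snoc (step b w) a = step b (Within-snoc w a)

  Within-1 : ∀ {u v} → Within 1 u v → u ≡ v ⊎ adj G u v ≡ true
  Within-1 here          = inj₁ refl
  Within-1 (step a here) = inj₂ a

  distLe⇒Within : ∀ m {u v} → distLe G m u v ≡ true → Within m u v
  distLe⇒Within zero e with refl ← isYes-sound e = here
  distLe⇒Within (suc m) {u} {v} e with ∨-elim {isYes (u ≟ v)} e
  ... | inj₁ u≡v with refl ← isYes-sound u≡v = here
  ... | inj₂ e′ with anyF-elim (λ w → adj G u w ∧ distLe G m w v) e′
  ...   | w , eʷ = step (∧-conicalˡ _ _ eʷ) (distLe⇒Within m (∧-conicalʳ _ _ eʷ))

  Within⇒distLe : ∀ {m u v} → Within m u v → distLe G m u v ≡ true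
  Within⇒distLe {zero}  {u} here = isYes-complete (u ≟ u) refl
  Within⇒distLe {suc m} {u} here = cong (_∨ anyF (λ w → adj G u w ∧ distLe G m w u)) (isYes-complete (u ≟ u) refl)
  Within⇒distLe {suc m} {u} {v} (step {w = w} a r) =
    ∨-introʳ (isYes (u ≟ v)) (anyF-intro (λ w → adj G u w ∧ distLe G m w v) w (cong₂ _∧_ a (Within⇒distLe r)))

  Within? : ∀ m u v → Dec (Within m u v)
  Within? m u v = map′ (distLe⇒Within m) Within⇒distLe (distLe G m u v ≟ᵇ true)

  isDist-suc⇒ : ∀ {i u v} → isDist G (suc i) u v ≡ true → Within (suc i) u v × ¬ Within i u v
  isDist-suc⇒ {i} e =
    distLe⇒Within (suc i) (∧-conicalˡ _ _ e) ,
    λ w → not-¬ (cong not (Within⇒distLe w)) (∧-conicalʳ _ _ e)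

  ⇒isDist-suc : ∀ {i u v} → Within (suc i) u v → ¬ Within i u v → isDist G (suc i) u v ≡ true
  ⇒isDist-suc w ¬w = cong₂ _∧_ (Within⇒distLe w) (cong not (¬-not (¬w ∘ distLe⇒Within _)))

  adj⇒isDist1 : ∀ {u v} → adj G u v ≡ true → isDist G 1 u v ≡ true
  adj⇒isDist1 {u} a = ⇒isDist-suc {0} (step a here) λ { here → not-¬ (irrefl G u) a }

  IsAut-flip : ∀ σ → IsAut G σ → IsAut G (flip σ)
  IsAut-flip σ isσ u v = trans (≡-sym (isσ (σ ⟨$⟩ˡ u) (σ ⟨$⟩ˡ v))) (cong₂ (adj G) (inverseʳ σ) (inverseʳ σ))

  IsAut-∘ : ∀ σ ρ → IsAut G σ → IsAut G ρ → IsAut G (σ ∘ₚ ρ)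
  IsAut-∘ σ ρ isσ isρ u v = trans (isρ (σ ⟨$⟩ʳ u) (σ ⟨$⟩ʳ v)) (isσ u v)

  Within-aut : ∀ σ {m u v} → IsAut G σ → Within m u v → Within m (σ ⟨$⟩ʳ u) (σ ⟨$⟩ʳ v)
  Within-aut σ isσ here       = here
  Within-aut σ isσ (step {u = u} {w} a r) = step (trans (isσ u w) a) (Within-aut σ isσ r)

  Within-aut⁻¹ : ∀ σ {m u v} → IsAut G σ → Within m (σ ⟨$⟩ʳ u) (σ ⟨$⟩ʳ v) → Within m u v
  Within-aut⁻¹ σ {m} isσ r = subst₂ (Within m) (inverseˡ σ) (inverseˡ σ) (Within-aut (flip σ) (IsAut-flip σ isσ) r)

  distLe-aut : ∀ σ → IsAut G σ → ∀ m u v → distLe G m (σ ⟨$⟩ʳ u) (σ ⟨$⟩ʳ v) ≡ distLe G m u v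
  distLe-aut σ isσ m u v = ≡-from-true⇔true
    (Within⇒distLe ∘ Within-aut⁻¹ σ isσ ∘ distLe⇒Within m)
    (Within⇒distLe ∘ Within-aut σ isσ ∘ distLe⇒Within m)

  isDist-aut : ∀ σ → IsAut G σ → ∀ i u v → isDist G i (σ ⟨$⟩ʳ u) (σ ⟨$⟩ʳ v) ≡ isDist G i u v
  isDist-aut σ isσ zero    u v = distLe-aut σ isσ 0 u v
  isDist-aut σ isσ (suc i) u v = cong₂ (λ a b → a ∧ not b) (distLe-aut σ isσ (suc i) u v) (distLe-aut σ isσ i u v)

  commonNbrs-aut : ∀ σ → IsAut G σ → ∀ u v → commonNbrs G (σ ⟨$⟩ʳ u) (σ ⟨$⟩ʳ v) ≡ commonNbrs G u v
  commonNbrs-aut σ isσ u v = begin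
    countF (λ z → adj G (σ ⟨$⟩ʳ u) z ∧ adj G (σ ⟨$⟩ʳ v) z)
      ≡⟨ countF-permute (λ z → adj G (σ ⟨$⟩ʳ u) z ∧ adj G (σ ⟨$⟩ʳ v) z) σ ⟨
    countF (λ z → adj G (σ ⟨$⟩ʳ u) (σ ⟨$⟩ʳ z) ∧ adj G (σ ⟨$⟩ʳ v) (σ ⟨$⟩ʳ z))
      ≡⟨ countF-cong (λ z → cong₂ _∧_ (isσ u z) (isσ v z)) ⟩
    countF (λ z → adj G u z ∧ adj G v z) ∎
    where open ≡-Reasoning

  PairTransitiveAt : ℕ → Set
  PairTransitiveAt i = ∀ u v u' v' → isDist G i u v ≡ true → isDist G i u' v' ≡ true →
    ∃[ σ ] IsAut G σ × σ ⟨$⟩ʳ u ≡ u' × σ ⟨$⟩ʳ v ≡ v'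

  pairTransitiveAt : VertexTransitive G → ∀ {i} → LocallyTransitiveAt G i → PairTransitiveAt i
  pairTransitiveAt vt {i} lt u v u' v' e e' with vt u u'
  ... | σ , isσ , refl with lt (σ ⟨$⟩ʳ u) (σ ⟨$⟩ʳ v) v' (trans (isDist-aut σ isσ i u v) e) e'
  ...   | ρ , isρ , ρσu , ρσv = σ ∘ₚ ρ , IsAut-∘ σ ρ isσ isρ , ρσu , ρσv

  pairTransitiveAt-0 : VertexTransitive G → PairTransitiveAt 0
  pairTransitiveAt-0 vt u v u' v' e e' with distLe⇒Within 0 e | distLe⇒Within 0 e' | vt u u'
  ... | here | here | σ , isσ , σu = σ , isσ , σu , σu

  commonNbrs-invariant : ∀ i → PairTransitiveAt i → ∀ {u v u' v'} →
    isDist G i u v ≡ true → isDist G i u' v' ≡ true → commonNbrs G u v ≡ commonNbrs G u' v'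
  commonNbrs-invariant i pt {u} {v} {u'} {v'} e e' with pt u v u' v' e e'
  ... | σ , isσ , refl , refl = ≡-sym (commonNbrs-aut σ isσ u v)

  neighbour-of-neighbour : ∀ {u v z} → adj G u v ≡ true → adj G v z ≡ true →
    u ≡ z ⊎ adj G u z ≡ true ⊎ isDist G 2 u z ≡ true
  neighbour-of-neighbour {u} {v} {z} uv vz with Within? 1 u z
  ... | yes r = map₂ inj₁ (Within-1 r)
  ... | no ¬r = inj₂ (inj₂ (⇒isDist-suc (step uv (step vz here)) ¬r))

  commonNbrs≤b1 : ∀ {u v x} → adj G u v ≡ true → ¬ Within 2 u x → commonNbrs G v x ≤ b1 G u v
  commonNbrs≤b1 {u} {v} {x} uv far = countF-mono common⊆b1
    where
    common⊆b1 : (λ z → adj G v z ∧ adj G x z) ⊆ (λ z → adj G v z ∧ isDist G 2 u z)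
    common⊆b1 z e with ∧-conicalˡ _ _ e | ∧-conicalʳ _ _ e
    ... | vz | xz with neighbour-of-neighbour uv vz
    ...   | inj₁ refl        = contradiction (Within-mono (n≤1+n 1) (step (trans (sym G z x) xz) here)) far
    ...   | inj₂ (inj₁ uz)   = contradiction (step uz (step (trans (sym G z x) xz) here)) far
    ...   | inj₂ (inj₂ d₂)   = cong₂ _∧_ vz d₂

  valency≤1+commonNbrs+b1 : ∀ {u v} → adj G u v ≡ true → countF (adj G v) ≤ suc (commonNbrs G v u + b1 G u v)
  valency≤1+commonNbrs+b1 {u} {v} uv =
    ≤-trans (countF-⊆-except u cover)
            (s≤s (countF-⊆-∪ {q = λ z → adj G v z ∧ adj G u z} {r = λ z → adj G v z ∧ isDist G 2 u z} λ _ → ∨-elim))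
    where
    cover : ∀ z → z ≢ u → adj G v z ≡ true → (adj G v z ∧ adj G u z) ∨ (adj G v z ∧ isDist G 2 u z) ≡ true
    cover z z≢u vz with neighbour-of-neighbour uv vz
    ... | inj₁ u≡z       = contradiction (≡-sym u≡z) z≢u
    ... | inj₂ (inj₁ uz) = cong (_∨ (adj G v z ∧ isDist G 2 u z)) (cong₂ _∧_ vz uz)
    ... | inj₂ (inj₂ d₂) = ∨-introʳ (adj G v z ∧ adj G u z) (cong₂ _∧_ vz d₂)

  2+commonNbrs≤c2+b1 : ∀ {u v w} → adj G u v ≡ true → adj G v w ≡ true → isDist G 2 u w ≡ true →
    2 + commonNbrs G v w ≤ c2 G u w + b1 G u v
  2+commonNbrs≤c2+b1 {u} {v} {w} uv vw uw =
    countF-⊆-∪-< cover v w (cong₂ _∧_ uv (trans (sym G w v) vw)) (cong (_∧ adj G w v) (irrefl G v))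
                           (cong₂ _∧_ vw uw) (trans (cong (adj G v w ∧_) (irrefl G w)) (∧-zeroʳ (adj G v w)))
    where
    cover : ∀ z → adj G v z ∧ adj G w z ≡ true → adj G u z ∧ adj G w z ≡ true ⊎ adj G v z ∧ isDist G 2 u z ≡ true
    cover z e with ∧-conicalˡ _ _ e | ∧-conicalʳ _ _ e
    ... | vz | wz with neighbour-of-neighbour uv vz
    ...   | inj₁ refl      = contradiction (step {m = 0} (trans (sym G u w) wz) here) (proj₂ (isDist-suc⇒ {1} uw))
    ...   | inj₂ (inj₁ uz) = inj₁ (cong₂ _∧_ uz wz)
    ...   | inj₂ (inj₂ d₂) = inj₂ (cong₂ _∧_ vz d₂)

  distance3-path : ∀ {u x} → isDist G 3 u x ≡ true →
    ∃₂ λ v w → adj G u v ≡ true × adj G v w ≡ true × adj G w x ≡ true × ¬ Within 2 u x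
  distance3-path {u} {x} e with isDist-suc⇒ {2} {u} {x} e
  ... | here                             , far = contradiction here far
  ... | step uv here                     , far = contradiction (step uv here) far
  ... | step uv (step vw here)           , far = contradiction (step uv (step vw here)) far
  ... | step uv (step vw (step wx here)) , far = _ , _ , uv , vw , wx , far

  arc-extends-to-geodesic : PairTransitiveAt 1 → ∀ {u₀ x₀} → isDist G 3 u₀ x₀ ≡ true →
    ∀ {u v} → adj G u v ≡ true → ∃₂ λ w x → adj G v w ≡ true × adj G w x ≡ true × ¬ Within 2 u x
  arc-extends-to-geodesic pt₁ {u₀} {x₀} e {u} {v} uv with distance3-path e
  ... | v₀ , w₀ , u₀v₀ , v₀w₀ , w₀x₀ , far with pt₁ u₀ v₀ u v (adj⇒isDist1 u₀v₀) (adj⇒isDist1 uv)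
  ...   | τ , isτ , refl , refl =
    τ ⟨$⟩ʳ w₀ , τ ⟨$⟩ʳ x₀ , trans (isτ v₀ w₀) v₀w₀ , trans (isτ w₀ x₀) w₀x₀ , far ∘ Within-aut⁻¹ τ isτ

  module _ (pt₁ : PairTransitiveAt 1) (pt₂ : PairTransitiveAt 2)
           {u v w x} (uv : adj G u v ≡ true) (vw : adj G v w ≡ true) (wx : adj G w x ≡ true)
           (far : ¬ Within 2 u x) where

    c2≤b1 : ∀ x' y' → isDist G 2 x' y' ≡ true → c2 G x' y' ≤ b1 G u v
    c2≤b1 x' y' e = begin
      c2 G x' y'         ≡⟨ commonNbrs-invariant 2 pt₂ e vx ⟩
      commonNbrs G v x   ≤⟨ commonNbrs≤b1 uv far ⟩
      b1 G u v           ∎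
      where
      open ≤-Reasoning
      vx : isDist G 2 v x ≡ true
      vx = ⇒isDist-suc (step vw (step wx here)) (far ∘ step uv)

    valency+1≤3b1 : countF (adj G v) + 1 ≤ 3 * b1 G u v
    valency+1≤3b1 = begin
      countF (adj G v) + 1        ≡⟨ +-comm (countF (adj G v)) 1 ⟩
      suc (countF (adj G v))      ≤⟨ s≤s (valency≤1+commonNbrs+b1 uv) ⟩
      2 + (commonNbrs G v u + b)  ≡⟨ cong (λ l → 2 + (l + b)) a₁-invariant ⟩
      2 + commonNbrs G v w + b    ≤⟨ +-monoˡ-≤ b (2+commonNbrs≤c2+b1 uv vw uw) ⟩
      c2 G u w + b + b            ≤⟨ +-monoˡ-≤ b (+-monoˡ-≤ b (c2≤b1 u w uw)) ⟩
      b + b + b                   ≡⟨ trans (+-assoc b b b) (cong (λ t → b + (b + t)) (≡-sym (+-identityʳ b))) ⟩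
      3 * b                       ∎
      where
      open ≤-Reasoning
      b : ℕ
      b = b1 G u v
      a₁-invariant : commonNbrs G v u ≡ commonNbrs G v w
      a₁-invariant = commonNbrs-invariant 1 pt₁ (adj⇒isDist1 (trans (sym G v u) uv)) (adj⇒isDist1 vw)
      uw : isDist G 2 u w ≡ true
      uw = ⇒isDist-suc (step uv (step vw here)) (λ r → far (Within-snoc r wx))

  no-distance-3⇒Within-2 : (¬ ∃₂ λ u v → isDist G 3 u v ≡ true) → ∀ {m u v} → Within m u v → Within 2 u v
  no-distance-3⇒Within-2 ∄₃ here = here
  no-distance-3⇒Within-2 ∄₃ {u = u} {v} (step uw r) with Within? 2 u v
  ... | yes r₂ = r₂
  ... | no ¬r₂ = contradiction (u , v , ⇒isDist-suc (step uw (no-distance-3⇒Within-2 ∄₃ r)) ¬r₂) ∄₃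

  module _ (within₂ : ∀ u v → Within 2 u v) where

    pairTransitiveAt-≥3 : ∀ i → PairTransitiveAt (3 + i)
    pairTransitiveAt-≥3 i u v _ _ e =
      contradiction (Within-mono (m≤m+n 2 i) (within₂ u v)) (proj₂ (isDist-suc⇒ {2 + i} e))

    distanceTransitive : VertexTransitive G → PairTransitiveAt 1 → PairTransitiveAt 2 → DistanceTransitive G
    distanceTransitive vt _   _   0               = pairTransitiveAt-0 vt
    distanceTransitive _  pt₁ _   1               = pt₁
    distanceTransitive _  _   pt₂ 2               = pt₂
    distanceTransitive _  _   _   (suc (suc (suc i))) = pairTransitiveAt-≥3 i

    stronglyRegular : ∀ {k} → HasValency G k → DiameterAtLeast2 G → PairTransitiveAt 1 → PairTransitiveAt 2 →
      StronglyRegular G k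
    stronglyRegular val (u₀ , w₀ , e₀) pt₁ pt₂ with isDist-suc⇒ {1} {u₀} {w₀} e₀
    ... | here , far = contradiction here far
    ... | step {w = v₀} u₀v₀ _ , _ =
      val , commonNbrs G u₀ v₀ , commonNbrs G u₀ w₀ ,
      (λ u v uv → commonNbrs-invariant 1 pt₁ (adj⇒isDist1 uv) (adj⇒isDist1 u₀v₀)) ,
      λ u v u≢v ¬uv →
        commonNbrs-invariant 2 pt₂ (⇒isDist-suc (within₂ u v) λ r → [ u≢v , not-¬ ¬uv ]′ (Within-1 r)) e₀

  AllWithin : ℕ → Set
  AllWithin d = ∀ u v → Within d u v

  AllWithin? : Decidable AllWithin
  AllWithin? d = all? λ u → all? λ v → Within? d u v

  diameter-attained : Fin n → ∀ {d} → AllWithin d → (∀ {d'} → d ≡ suc d' → ¬ AllWithin d') →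
    ∃[ u ] ∃[ v ] isDist G d u v ≡ true
  diameter-attained u₀ {zero}  _   _        = u₀ , u₀ , Within⇒distLe {0} here
  diameter-attained _  {suc d} all boundary
    with u , ¬all-v ← ¬∀⟶∃¬ n _ (λ u → all? (Within? d u)) (boundary refl)
    with v , ¬r ← ¬∀⟶∃¬ n _ (Within? d u) ¬all-v
    = u , v , ⇒isDist-suc (all u v) ¬r

  Connected⇒AllWithin : Connected G → ∃[ M ] AllWithin M
  Connected⇒AllWithin conn = uniform-bound (λ le f v → Within-mono le (f v)) λ u →
    uniform-bound Within-mono λ v → proj₁ (conn u v) , distLe⇒Within (proj₁ (conn u v)) (proj₂ (conn u v))

  hasDiameter : Connected G → Fin n → ∃[ d ] HasDiameter G d
  hasDiameter conn u₀ with descend AllWithin? (proj₂ (Connected⇒AllWithin conn))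
  ... | d , all , boundary = d , diameter-attained u₀ all boundary , λ u v → Within⇒distLe (all u v)

  ¬Within⇒<diameter : ∀ {d m u v} → HasDiameter G d → ¬ Within m u v → m < d
  ¬Within⇒<diameter {d} (_ , all) ¬r = ≰⇒> λ d≤m → ¬r (Within-mono d≤m (distLe⇒Within d (all _ _)))

lemma6p2 : (n : ℕ) (G : Graph n) (k : ℕ) → Connected G → HasValency G k → 3 ≤ k →
    TwoDistanceTransitive G →
    (DistanceTransitive G × StronglyRegular G k)
    ⊎ ((∃[ d ] (HasDiameter G d × 3 ≤ d)) ×
       (∀ u v → adj G u v ≡ true →
          (∀ x y → isDist G 2 x y ≡ true → c2 G x y ≤ b1 G u v) × (k + 1 ≤ 3 * b1 G u v)))
lemma6p2 n G k conn val _ (diam₂ , vt , lt₁ , lt₂)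
  with pairTransitiveAt G vt {1} lt₁ | pairTransitiveAt G vt {2} lt₂ | any? (λ u → any? λ x → isDist G 3 u x ≟ᵇ true)
... | pt₁ | pt₂ | no ∄₃ = inj₁ (distanceTransitive G within₂ vt pt₁ pt₂ , stronglyRegular G within₂ val diam₂ pt₁ pt₂)
  where
  within₂ : ∀ u v → Within G 2 u v
  within₂ u v = no-distance-3⇒Within-2 G ∄₃ (distLe⇒Within G (proj₁ (conn u v)) (proj₂ (conn u v)))
... | pt₁ | pt₂ | yes (u₀ , x₀ , e₃) with hasDiameter G conn u₀
...   | d , diam = inj₂ ((d , diam , ¬Within⇒<diameter G diam (proj₂ (isDist-suc⇒ G {2} {u₀} {x₀} e₃))) , bounds)
  where
  bounds : ∀ u v → adj G u v ≡ true →
    (∀ x y → isDist G 2 x y ≡ true → c2 G x y ≤ b1 G u v) × (k + 1 ≤ 3 * b1 G u v)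
  bounds u v uv with arc-extends-to-geodesic G pt₁ {u₀} {x₀} e₃ uv
  ... | w , x , vw , wx , far =
    c2≤b1 G pt₁ pt₂ uv vw wx far ,
    subst (λ k′ → k′ + 1 ≤ 3 * b1 G u v) (val v) (valency+1≤3b1 G pt₁ pt₂ uv vw wx far)
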